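{- (i) If $\mathbf P=(P,\le,{}',0,1)$ is a finite Boolean poset, then $\mathbb B(\mathbb D(\mathbf P))=\mathbf P$. (ii) If $\mathbf D=(P,+,\cdot,0,1)$ is a finite dual of a Boolean poset and $\mathbb D(\mathbb B(\mathbf D))=(P,\oplus,\odot,0,1)$, then $A\odot B=A\cdot B$ for all subsets $A,B\subseteq P$ (in particular for all elements), i.e. $(P,\odot,0,1)=(P,\cdot,0,1)$.
   Context: For a poset and $X\subseteq P$: $L(X)$, $U(X)$ are the sets of lower/upper bounds; $\operatorname{Max}$, $\operatorname{Min}$ the sets of maximal/minimal elements; $L(x,y)=L(\{x,y\})$, $LU(X)=L(U(X))$. A complemented poset is a bounded poset $(P,\le,{}',0,1)$ with an antitone involution $'$ such that $L(x,x')=\{0\}$, $U(x,x')=\{1\}$. A poset is distributive if $L(U(x,y),z)=LU(L(x,z),L(y,z))$ for all $x,y,z$; a Boolean poset is a distributive complemented poset. A dual of a Boolean poset is a structure $(P,+,\cdot,0,1)$ where $+,\cdot$ are binary operators on $P$ (defined on pairs of elements and of subsets, with values subsets of $P$; elements identified with singletons), $0,1\in P$, such that for all $x,y,z\in P$ and $A,B\subseteq P$: (i) $x\cdot x=x$, $x\cdot y=y\cdot x$, $x\cdot0=0$, $x\cdot1=x$, $(x\cdot(y\cdot z))\cdot z=(x\cdot(y\cdot z))\cdot1$; (ii) $(x+1)+1=x$; (iii) $x\cdot y=x$ implies $(x+1)\cdot(y+1)=y+1$; (iv) $x\cdot(x+1)=0$; (v) $\big(((x+1)\cdot(y+1))+1\big)\cdot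 z=\big((((x\cdot z)+1)\cdot((y\cdot z)+1))+1\big)\cdot1$; (vi) $x\in A\cdot B$ iff [$x\cdot y=x$ for all $y\in A\cup B$, and every $z$ with $x\cdot z=x$ and $z\cdot y=z$ for all $y\in A\cup B$ satisfies $z=x$]. For a finite Boolean poset $\mathbf P=(P,\le,{}',0,1)$, $\mathbb D(\mathbf P):=(P,+,\cdot,0,1)$ with $A+B:=\operatorname{Min}U\big(\operatorname{Max}L(A'\cup B)\cup\operatorname{Max}L(A\cup B')\big)$ and $A\cdot B:=\operatorname{Max}L(A\cup B)$ for subsets $A,B$ (where $A'=\{a'\mid a\in A\}$); this is a dual of a Boolean poset. For a finite dual $\mathbf D=(P,+,\cdot,0,1)$ of a Boolean poset, $\mathbb B(\mathbf D):=(P,\le,{}',0,1)$ with $x\le y$ iff $x\cdot y=x$ and $x':=x+1$; this is a Boolean poset. -}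

module Defs where

open import Data.Nat using (ℕ)
open import Data.Fin using (Fin)
open import Data.Product using (_×_; Σ; ∃; _,_)
open import Relation.Binary.PropositionalEquality using (_≡_)
open import Relation.Binary.Structures using (IsPartialOrder)
open import Function.Bundles using (_⇔_)
open import Relation.Unary using (Pred; _∈_; _∪_; _≐_; ｛_｝) public

-- A finite carrier is taken to be Fin n; subsets are predicates on it,
-- compared extensionally with _≐_; an element x is identified with ｛ x ｝.
Sub : ℕ → Set₁
Sub n = Pred (Fin n) _

module _ {n : ℕ} (_≤_ : Fin n → Fin n → Set) where
  L : Sub n → Sub n
  L X z = ∀ y → y ∈ X → z ≤ y

  U : Sub n → Sub n
  U X z = ∀ y → y ∈ X → y ≤ z

  Max : Sub n → Sub n
  Max X z = z ∈ X × (∀ w → w ∈ X → z ≤ w → w ≡ z)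

  Min : Sub n → Sub n
  Min X z = z ∈ X × (∀ w → w ∈ X → w ≤ z → w ≡ z)

pair : {n : ℕ} → Fin n → Fin n → Sub n
pair x y = ｛ x ｝ ∪ ｛ y ｝

img : {n : ℕ} → (Fin n → Fin n) → Sub n → Sub n
img f A z = ∃ λ a → a ∈ A × z ≡ f a

record IsBooleanPoset {n : ℕ} (_≤_ : Fin n → Fin n → Set)
       (_′ : Fin n → Fin n) (𝟘 𝟙 : Fin n) : Set₁ where
  field
    isPartialOrder : IsPartialOrder _≡_ _≤_
    bottom  : ∀ x → 𝟘 ≤ x
    top     : ∀ x → x ≤ 𝟙
    antitone : ∀ x y → x ≤ y → (y ′) ≤ (x ′)
    involutive : ∀ x → ((x ′) ′) ≡ x
    L-compl : ∀ x → L _≤_ (pair x (x ′)) ≐ ｛ 𝟘 ｝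
    U-compl : ∀ x → U _≤_ (pair x (x ′)) ≐ ｛ 𝟙 ｝
    distrib : ∀ x y z →
      L _≤_ (U _≤_ (pair x y) ∪ ｛ z ｝)
        ≐ L _≤_ (U _≤_ (L _≤_ (pair x z) ∪ L _≤_ (pair y z)))

DMul : {n : ℕ} (_≤_ : Fin n → Fin n → Set) → Sub n → Sub n → Sub n
DMul _≤_ A B = Max _≤_ (L _≤_ (A ∪ B))

module _ {n : ℕ} (_≤_ : Fin n → Fin n → Set) (_′ : Fin n → Fin n) where
  DAdd : Sub n → Sub n → Sub n
  DAdd A B = Min _≤_ (U _≤_ (Max _≤_ (L _≤_ (img _′ A ∪ B))
                           ∪ Max _≤_ (L _≤_ (A ∪ img _′ B))))

-- Dual of a Boolean poset on Fin n (operators act on subsets;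
-- an element x stands for the singleton ｛ x ｝)
record IsDualBoolean {n : ℕ} (_+_ _·_ : Sub n → Sub n → Sub n) (𝟘 𝟙 : Fin n) : Set₁ where
  private
    e : Fin n → Sub n
    e x = ｛ x ｝
  field
    idem   : ∀ x → (e x · e x) ≐ e x
    comm   : ∀ x y → (e x · e y) ≐ (e y · e x)
    zero-r : ∀ x → (e x · e 𝟘) ≐ e 𝟘
    one-r  : ∀ x → (e x · e 𝟙) ≐ e x
    ax-i5  : ∀ x y z → ((e x · (e y · e z)) · e z) ≐ ((e x · (e y · e z)) · e 𝟙)
    invol  : ∀ x → ((e x + e 𝟙) + e 𝟙) ≐ e x
    anti   : ∀ x y → (e x · e y) ≐ e x → ((e x + e 𝟙) · (e y + e 𝟙)) ≐ (e y + e 𝟙)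
    compl  : ∀ x → (e x · (e x + e 𝟙)) ≐ e 𝟘
    ax-v   : ∀ x y z →
      ((((e x + e 𝟙) · (e y + e 𝟙)) + e 𝟙) · e z)
        ≐ (((((e x · e z) + e 𝟙) · ((e y · e z) + e 𝟙)) + e 𝟙) · e 𝟙)
    ax-vi  : ∀ x (A B : Sub n) →
      (x ∈ (A · B)) ⇔
      ((∀ y → y ∈ (A ∪ B) → (e x · e y) ≐ e x) ×
       (∀ z → (e x · e z) ≐ e x → (∀ y → y ∈ (A ∪ B) → (e z · e y) ≐ e z) → z ≡ x))

module _ {n : ℕ} (_+_ _·_ : Sub n → Sub n → Sub n) (𝟙 : Fin n) where
  BLe : Fin n → Fin n → Set
  BLe x y = (｛ x ｝ · ｛ y ｝) ≐ ｛ x ｝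

  BCompl : Fin n → Sub n
  BCompl x = ｛ x ｝ + ｛ 𝟙 ｝

-- In 𝔻(P), x · y = Max L{x,y} is {x} exactly when x ≤ y, since then x is the
-- greatest element of L{x,y}; and x + 1 = Min U(Max L{x′,1} ∪ Max L{x,1′}) = {x′},
-- because x′ lies in the first set and, as 1′ = 0, bounds everything in both.
-- Conversely, axiom (vi) of a dual literally says that A · B is the set of
-- maximal lower bounds of A ∪ B for the order of 𝔹(D).
module Submission where

open import Defs
open import Data.Nat using (ℕ)
open import Data.Fin using (Fin)
open import Data.Product using (_×_; _,_; proj₁; proj₂)
open import Data.Sum using (inj₁; inj₂)
open import Function.Bundles using (_⇔_; mk⇔; Equivalence)
open import Relation.Binary.PropositionalEquality using (_≡_; refl; sym; subst)
open import Relation.Binary.Structures using (IsPartialOrder)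

module _ {n : ℕ} {_≤_ : Fin n → Fin n → Set} (po : IsPartialOrder _≡_ _≤_) where
  open IsPartialOrder po using (antisym)

  Max-greatest : ∀ {X : Sub n} {g} → g ∈ X → (∀ z → z ∈ X → z ≤ g) →
                 Max _≤_ X ≐ ｛ g ｝
  Max-greatest {g = g} g∈X greatest =
      (λ (z∈X , maximal) → maximal g g∈X (greatest _ z∈X))
    , λ { refl → g∈X , λ w w∈X g≤w → antisym (greatest w w∈X) g≤w }

  Min-least : ∀ {X : Sub n} {l} → l ∈ X → (∀ z → z ∈ X → l ≤ z) →
              Min _≤_ X ≐ ｛ l ｝
  Min-least {l = l} l∈X least =
      (λ (z∈X , minimal) → minimal l l∈X (least _ z∈X))
    , λ { refl → l∈X , λ w w∈X w≤l → antisym w≤l (least w w∈X) }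

module BooleanPoset {n : ℕ} {_≤_ : Fin n → Fin n → Set} {_′ : Fin n → Fin n} {𝟘 𝟙 : Fin n}
                    (P : IsBooleanPoset _≤_ _′ 𝟘 𝟙) where
  open IsBooleanPoset P
  open IsPartialOrder isPartialOrder using (trans) renaming (refl to ≤-refl)

  1′≡0 : (𝟙 ′) ≡ 𝟘
  1′≡0 = sym (L-compl 𝟙 .proj₁ 1′-lower)
    where
    1′-lower : (𝟙 ′) ∈ L _≤_ (pair 𝟙 (𝟙 ′))
    1′-lower _ (inj₁ refl) = top _
    1′-lower _ (inj₂ refl) = ≤-refl

  ≤⇔BLe : ∀ x y → (x ≤ y) ⇔ BLe (DAdd _≤_ _′) (DMul _≤_) 𝟙 x y
  ≤⇔BLe x y = mk⇔ meet-is-x (λ (_ , x∈meet) → x∈meet refl .proj₁ y (inj₂ refl))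
    where
    meet-is-x : x ≤ y → DMul _≤_ ｛ x ｝ ｛ y ｝ ≐ ｛ x ｝
    meet-is-x x≤y = Max-greatest isPartialOrder x-lower (λ z z-lower → z-lower x (inj₁ refl))
      where
      x-lower : x ∈ L _≤_ (pair x y)
      x-lower _ (inj₁ refl) = ≤-refl
      x-lower _ (inj₂ refl) = x≤y

  BCompl≐′ : ∀ x → BCompl (DAdd _≤_ _′) (DMul _≤_) 𝟙 x ≐ ｛ x ′ ｝
  BCompl≐′ x = Min-least isPartialOrder x′-upper (λ z z-upper → z-upper (x ′) x′∈S)
    where
    S : Sub n
    S = Max _≤_ (L _≤_ (img _′ ｛ x ｝ ∪ ｛ 𝟙 ｝)) ∪ Max _≤_ (L _≤_ (｛ x ｝ ∪ img _′ ｛ 𝟙 ｝))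

    below-x′ : ∀ {s} → s ∈ L _≤_ (img _′ ｛ x ｝ ∪ ｛ 𝟙 ｝) → s ≤ (x ′)
    below-x′ s-lower = s-lower (x ′) (inj₁ (x , refl , refl))

    x′-lower : (x ′) ∈ L _≤_ (img _′ ｛ x ｝ ∪ ｛ 𝟙 ｝)
    x′-lower _ (inj₁ (_ , refl , refl)) = ≤-refl
    x′-lower _ (inj₂ refl) = top _

    x′∈S : (x ′) ∈ S
    x′∈S = inj₁ (Max-greatest isPartialOrder x′-lower (λ _ → below-x′) .proj₂ refl)

    x′-upper : (x ′) ∈ U _≤_ S
    x′-upper s (inj₁ (s-lower , _)) = below-x′ s-lower
    x′-upper s (inj₂ (s-lower , _)) =
      trans (subst (s ≤_) 1′≡0 (s-lower (𝟙 ′) (inj₂ (𝟙 , refl , refl)))) (bottom _)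

DMul-BLe≐· : ∀ {n} {_+_ _·_ : Sub n → Sub n → Sub n} {𝟘 𝟙 : Fin n} →
             IsDualBoolean _+_ _·_ 𝟘 𝟙 →
             ∀ (A B : Sub n) → DMul (BLe _+_ _·_ 𝟙) A B ≐ (A · B)
DMul-BLe≐· D A B =
    (λ (z-lower , maximal) → from (ax-vi _ A B) (z-lower , λ w z≤w w-lower → maximal w w-lower z≤w))
  , λ z∈A·B → let (z-lower , maximal) = to (ax-vi _ A B) z∈A·B
              in z-lower , λ w w-lower z≤w → maximal w z≤w w-lower
  where
  open IsDualBoolean D
  open Equivalence

theorem5p4 : (∀ (n : ℕ) (_≤_ : Fin n → Fin n → Set) (_′ : Fin n → Fin n) (𝟘 𝟙 : Fin n) →
    IsBooleanPoset _≤_ _′ 𝟘 𝟙 →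
    (∀ x y → (x ≤ y) ⇔ BLe (DAdd _≤_ _′) (DMul _≤_) 𝟙 x y)
    × (∀ x → BCompl (DAdd _≤_ _′) (DMul _≤_) 𝟙 x ≐ ｛ x ′ ｝))
    ×
    (∀ (n : ℕ) (_+_ _·_ : Sub n → Sub n → Sub n) (𝟘 𝟙 : Fin n) →
    IsDualBoolean _+_ _·_ 𝟘 𝟙 →
    ∀ (A B : Sub n) → DMul (BLe _+_ _·_ 𝟙) A B ≐ (A · B))
theorem5p4 = (λ _ _ _ _ _ P → BooleanPoset.≤⇔BLe P , BooleanPoset.BCompl≐′ P)
           , λ _ _ _ _ _ D → DMul-BLe≐· D
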